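{- Let $i\ge 2$ and let $j$ be a positive integer with $j\le i$. Let $K_i$ be the complete graph on the vertex set $[i]=\{1,\ldots,i\}$ with edge set $E=E(K_i)$, let $P_{i,j}\subseteq\mathbb{K}[x_e : e\in E]$ be the ideal generated by the monomials $m_C$ of all $j$-partitions $C$ of $[i]$, and let $\Delta_{i,j}$ be the simplicial complex on $E$ associated to $P_{i,j}$, i.e. $\Delta_{i,j}=\{F\subseteq E : \prod_{e\in F}x_e\notin P_{i,j}\}$. Then a set $F\subseteq E$ is a facet of $\Delta_{i,j}$ if and only if $F=E\setminus S$ for some set $S\subseteq E$ of edges with $|S|=i-j+1$ such that $S$ contains no cycle. In particular, $F$ is a facet of $\Delta_{i,2}$ if and only if $F=E\setminus T$ for a spanning tree $T$ of $K_i$.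
   Context: $\mathbb{K}$ is a field. A $j$-partition of $[i]$ is a partition $C=A_1|A_2|\cdots|A_j$ of $[i]$ into $j$ pairwise disjoint nonempty subsets (in $K_i$ every such partition is a $j$-cut, since each block induces a connected subgraph). For such $C$, $E(C)$ is the set of edges $\{a,b\}$ of $K_i$ with $a,b$ in different blocks, and $m_C=\prod_{e\in E(C)}x_e$. A facet of a simplicial complex is a face maximal under inclusion. -}

module Defs where

open import Data.Nat using (ℕ; zero; suc)
open import Data.Fin using (Fin; zero; suc; _<_; _<?_; inject₁; fromℕ)
open import Data.Fin.Properties using () 
open import Data.Bool using (Bool; true; false; not; T)
open import Data.Bool.Properties using (T?)
open import Data.List using (List; length; filter; concatMap; map)
open import Data.List using () renaming (allFin to allFinL)
open import Data.Product using (Σ; ∃; _×_; _,_; proj₁; proj₂)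
open import Data.Sum using (_⊎_)
open import Relation.Nullary using (¬_)
open import Relation.Nullary.Decidable using (_×-dec_)
open import Relation.Binary.PropositionalEquality using (_≡_; _≢_)
open import Function.Definitions using (Injective; Surjective)

-- Vertices of K_i are Fin i (standing for [i]).
-- An edge {a,b} of K_i is represented by the ordered pair (a , b) with a < b.
-- A set of edges is a Bool-valued function; only the entries S a b with a < b
-- are meaningful (the others are ignored by every definition below).
EdgeSet : ℕ → Set
EdgeSet i = Fin i → Fin i → Bool

_∋ₑ_,_ : ∀ {i} → EdgeSet i → Fin i → Fin i → Set
S ∋ₑ a , b = a < b × T (S a b)

_⊆ₑ_ : ∀ {i} → EdgeSet i → EdgeSet i → Set
F ⊆ₑ G = ∀ a b → F ∋ₑ a , b → G ∋ₑ a , b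

_≐ₑ_ : ∀ {i} → EdgeSet i → EdgeSet i → Set
F ≐ₑ G = F ⊆ₑ G × G ⊆ₑ F

compl : ∀ {i} → EdgeSet i → EdgeSet i
compl S a b = not (S a b)

allPairs : ∀ i → List (Fin i × Fin i)
allPairs i = concatMap (λ a → map (λ b → (a , b)) (allFinL i)) (allFinL i)

card : ∀ {i} → EdgeSet i → ℕ
card {i} S = length (filter (λ p → (proj₁ p <? proj₂ p) ×-dec T? (S (proj₁ p) (proj₂ p))) (allPairs i))

-- A j-partition of [i], given by a surjective block labelling c : [i] → [j]
-- (blocks A_k = c⁻¹(k), all nonempty by surjectivity).
record Partition (i j : ℕ) : Set where
  field
    block : Fin i → Fin j
    surj  : Surjective _≡_ _≡_ block
open Partition public

-- The edge set E(C): edges whose endpoints lie in different blocks.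
-- m_C divides the squarefree monomial ∏_{e∈F} x_e iff E(C) ⊆ F.
cutEdgesIn : ∀ {i j} → Partition i j → EdgeSet i → Set
cutEdgesIn C F = ∀ a b → a < b → block C a ≢ block C b → F ∋ₑ a , b

-- F ∈ Δ_{i,j}  iff  ∏_{e∈F} x_e ∉ P_{i,j}
-- iff no generator m_C of the monomial ideal P_{i,j} divides ∏_{e∈F} x_e.
Face : (i j : ℕ) → EdgeSet i → Set
Face i j F = ¬ (Σ (Partition i j) λ C → cutEdgesIn C F)

Facet : (i j : ℕ) → EdgeSet i → Set
Facet i j F = Face i j F × (∀ G → Face i j G → F ⊆ₑ G → G ⊆ₑ F)

Adj : ∀ {i} → EdgeSet i → Fin i → Fin i → Set
Adj S u v = (S ∋ₑ u , v) ⊎ (S ∋ₑ v , u)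

HasCycle : ∀ {i} → EdgeSet i → Set
HasCycle {i} S =
  Σ ℕ λ n → Σ (Fin (suc (suc (suc n))) → Fin i) λ v →
    Injective _≡_ _≡_ v ×
    (∀ (t : Fin (suc (suc n))) → Adj S (v (inject₁ t)) (v (suc t))) ×
    Adj S (v (fromℕ (suc (suc n)))) (v zero)

Acyclic : ∀ {i} → EdgeSet i → Set
Acyclic S = ¬ HasCycle S

data Walk {i} (S : EdgeSet i) : Fin i → Fin i → Set where
  here : ∀ {u} → Walk S u u
  step : ∀ {u w v} → Adj S u w → Walk S w v → Walk S u v

Connected : ∀ {i} → EdgeSet i → Set
Connected {i} S = ∀ (u v : Fin i) → Walk S u v

SpanningTree : ∀ {i} → EdgeSet i → Set
SpanningTree S = Acyclic S × Connected S

{-# OPTIONS --safe #-}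
-- F is a face of Δ_{i,j} iff no j-partition has all its cut edges in F, i.e. iff the graph
-- ([i], E ∖ F) has fewer than j connected components.  Deleting an edge from a graph raises
-- the number of components by one if the edge lies on no cycle and leaves it unchanged
-- otherwise.  So F is a facet iff S = E ∖ F has exactly j − 1 components and no cycle, and a
-- forest on i vertices with j − 1 components has i − (j − 1) edges.  For j = 2 the forests
-- with one component are the spanning trees.
module Submission where

open import Defs
open import Data.Nat as ℕ using (ℕ; zero; suc; pred; _+_; _∸_; _≤_; _<_; _≤′_; z≤n; s≤s)
import Data.Nat.Properties as ℕ
open import Data.Fin as Fin using (Fin; zero; suc; inject₁; fromℕ; punchIn; punchOut; _≟_; _<?_)
import Data.Fin.Properties as Fin
open import Data.Bool using (true; false; not; _∧_; T)
open import Data.Bool.Properties using (T?; T-∧; not-involutive)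
open import Data.Unit using (tt)
open import Data.List using (List; []; _∷_; _++_; length; filter; map; concatMap; cartesianProduct; allFin)
open import Data.List.Relation.Unary.Any using (here; there)
open import Data.List.Relation.Unary.All as All using (All; []; _∷_)
open import Data.List.Relation.Unary.All.Properties using (¬Any⇒All¬)
open import Data.List.Relation.Unary.AllPairs using ([]; _∷_)
open import Data.List.Relation.Unary.Unique.Propositional using (Unique)
open import Data.List.Relation.Unary.Unique.Propositional.Properties using (allFin⁺; cartesianProduct⁺)
open import Data.List.Membership.Propositional using (_∈_)
open import Data.List.Membership.Propositional.Properties using (∈-filter⁻; ∈-allFin; ∈-cartesianProduct⁺)
import Data.List.Membership.DecPropositional as DecMembership
import Data.List.Properties as List
open import Data.Product using (Σ; ∃; ∃₂; _×_; _,_; proj₁; proj₂; swap)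
open import Data.Product.Properties using (≡-dec)
open import Data.Sum as Sum using (_⊎_; inj₁; inj₂; [_,_]′)
open import Function using (_∘_; id)
open import Function.Bundles using (_⇔_; mk⇔; Equivalence)
open import Function.Properties.Equivalence using () renaming (trans to ⇔-trans)
open import Function.Definitions using (Injective; StrictlySurjective)
open import Function.Consequences.Propositional using (strictlySurjective⇒surjective)
open import Relation.Nullary using (¬_; Dec; yes; no; does; contradiction)
open import Relation.Nullary.Decidable using (_×-dec_; toSum)
open import Relation.Unary using (Pred; Decidable)
open import Relation.Binary.PropositionalEquality using (_≡_; _≢_; refl; sym; trans; cong; subst; module ≡-Reasoning)

T-not : ∀ {x} → T (not x) ⇔ (¬ T x)
T-not {true}  = mk⇔ (λ ()) (λ ¬t → ¬t tt)
T-not {false} = mk⇔ (λ _ ()) (λ _ → tt)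

T-not-does : ∀ {p} {P : Set p} (P? : Dec P) → T (not (does P?)) ⇔ (¬ P)
T-not-does (yes p) = mk⇔ (λ ()) (λ ¬p → ¬p p)
T-not-does (no ¬p) = mk⇔ (λ _ → ¬p) (λ _ → tt)

module _ {a p q} {A : Set a} {P : Pred A p} {Q : Pred A q} (P? : Decidable P) (Q? : Decidable Q) where

  length-filter-cong : ∀ {xs} → All (λ x → P x ⇔ Q x) xs → length (filter P? xs) ≡ length (filter Q? xs)
  length-filter-cong {[]}     []           = refl
  length-filter-cong {x ∷ xs} (Px⇔Qx ∷ eqs) with P? x | Q? x
  ... | yes _  | yes _  = cong suc (length-filter-cong eqs)
  ... | no  _  | no  _  = length-filter-cong eqs
  ... | yes Px | no ¬Qx = contradiction (Equivalence.to Px⇔Qx Px) ¬Qx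
  ... | no ¬Px | yes Qx = contradiction (Equivalence.from Px⇔Qx Qx) ¬Px

  length-filter-without : ∀ {y xs} → (∀ {x} → Q x ⇔ (P x × x ≢ y)) → Unique xs → y ∈ xs → P y →
                          length (filter P? xs) ≡ suc (length (filter Q? xs))
  length-filter-without {y} {y ∷ xs} Q⇔P∖y (y∉xs ∷ _) (here refl) Py with P? y | Q? y
  ... | no ¬Py | _      = contradiction Py ¬Py
  ... | yes _  | yes Qy = contradiction refl (proj₂ (Equivalence.to Q⇔P∖y Qy))
  ... | yes _  | no  _  = cong suc (length-filter-cong (All.map P⇔Q y∉xs))
    where
    P⇔Q : ∀ {x} → y ≢ x → P x ⇔ Q x
    P⇔Q y≢x = mk⇔ (λ Px → Equivalence.from Q⇔P∖y (Px , y≢x ∘ sym)) (proj₁ ∘ Equivalence.to Q⇔P∖y)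
  length-filter-without {y} {x ∷ xs} Q⇔P∖y (x∉xs ∷ xs-unique) (there y∈xs) Py with P? x | Q? x
  ... | yes _  | yes _  = cong suc (length-filter-without Q⇔P∖y xs-unique y∈xs Py)
  ... | no  _  | no  _  = length-filter-without Q⇔P∖y xs-unique y∈xs Py
  ... | yes Px | no ¬Qx = contradiction (Equivalence.from Q⇔P∖y (Px , λ { refl → All.lookup x∉xs y∈xs refl })) ¬Qx
  ... | no ¬Px | yes Qx = contradiction (proj₁ (Equivalence.to Q⇔P∖y Qx)) ¬Px

concatMap-pairs≡cartesianProduct : ∀ {a b} {A : Set a} {B : Set b} (xs : List A) (ys : List B) →
                                   concatMap (λ x → map (λ y → (x , y)) ys) xs ≡ cartesianProduct xs ys
concatMap-pairs≡cartesianProduct []       ys = refl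
concatMap-pairs≡cartesianProduct (x ∷ xs) ys = cong (map (x ,_) ys ++_) (concatMap-pairs≡cartesianProduct xs ys)

length≡suc⇒∈ : ∀ {a} {A : Set a} {xs : List A} {k} → length xs ≡ suc k → ∃ (_∈ xs)
length≡suc⇒∈ {xs = x ∷ _} _ = x , here refl

module _ {m} {α β : Fin (suc m)} (β≢α : β ≢ α) where

  identify : Fin (suc m) → Fin m
  identify z with β ≟ z
  ... | yes _   = punchOut β≢α
  ... | no β≢z = punchOut β≢z

  identify-merges : identify β ≡ identify α
  identify-merges with β ≟ β | β ≟ α
  ... | no β≢β | _       = contradiction refl β≢β
  ... | yes _  | yes β≡α = contradiction β≡α β≢α
  ... | yes _  | no _    = Fin.punchOut-cong β refl

  identify-surjective : StrictlySurjective _≡_ identify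
  identify-surjective k = punchIn β k , identify-punchIn
    where
    identify-punchIn : identify (punchIn β k) ≡ k
    identify-punchIn with β ≟ punchIn β k
    ... | yes β≡βₖ = contradiction (sym β≡βₖ) (Fin.punchInᵢ≢i β k)
    ... | no  _    = Fin.punchOut-punchIn β

  identify-injective : ∀ {z z′} → identify z ≡ identify z′ →
                       z ≡ z′ ⊎ (z ≡ β × z′ ≡ α) ⊎ (z ≡ α × z′ ≡ β)
  identify-injective {z} {z′} eq with β ≟ z | β ≟ z′
  ... | yes refl | yes refl = inj₁ refl
  ... | yes refl | no β≢z′  = inj₂ (inj₁ (refl , Fin.punchOut-injective β≢z′ β≢α (sym eq)))
  ... | no β≢z   | yes refl = inj₂ (inj₂ (Fin.punchOut-injective β≢z β≢α eq , refl))
  ... | no β≢z   | no β≢z′  = inj₁ (Fin.punchOut-injective β≢z β≢z′ eq)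

suc≡⇔≡∸+1 : ∀ {m c n j} → m + c ≡ n → j ≤ n → suc m ≡ j ⇔ c ≡ n ∸ j + 1
suc≡⇔≡∸+1 {m} {c} {n} {j} m+c≡n j≤n = mk⇔ to from
  where
  open ≡-Reasoning
  to : suc m ≡ j → c ≡ n ∸ j + 1
  to refl = begin
    c                   ≡⟨ sym (ℕ.m+n∸m≡n (suc m) c) ⟩
    suc m + c ∸ suc m   ≡⟨ cong (_∸ suc m) (trans (cong suc m+c≡n) (ℕ.+-comm 1 n)) ⟩
    n + 1 ∸ suc m       ≡⟨ ℕ.+-∸-comm 1 j≤n ⟩
    n ∸ suc m + 1       ∎
  from : c ≡ n ∸ j + 1 → suc m ≡ j
  from refl = ℕ.+-cancelʳ-≡ (n ∸ j) (suc m) j (begin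
    suc m + (n ∸ j)     ≡⟨ sym (ℕ.+-suc m (n ∸ j)) ⟩
    m + suc (n ∸ j)     ≡⟨ cong (m +_) (ℕ.+-comm 1 (n ∸ j)) ⟩
    m + (n ∸ j + 1)     ≡⟨ m+c≡n ⟩
    n                   ≡⟨ sym (ℕ.m+[n∸m]≡n j≤n) ⟩
    j + (n ∸ j)         ∎)

Fin1-unique : ∀ {m} → m ≡ 1 → (x y : Fin m) → x ≡ y
Fin1-unique refl zero zero = refl

≡suc-pred : ∀ {m} → Fin m → m ≡ suc (pred m)
≡suc-pred {suc _} _ = refl

module _ {i : ℕ} where

  open DecMembership (_≟_ {i}) using (_∈?_)

  private
    V : Set
    V = Fin i
    variable
      S S′ F G H : EdgeSet i
      a b u v w x y : V

  -- Edge sets and walks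

  ⊆ₑ-trans : F ⊆ₑ G → G ⊆ₑ H → F ⊆ₑ H
  ⊆ₑ-trans F⊆G G⊆H a b = G⊆H a b ∘ F⊆G a b

  compl-antitone : F ⊆ₑ G → compl G ⊆ₑ compl F
  compl-antitone F⊆G a b (a<b , ¬Gab) =
    a<b , Equivalence.from T-not (Equivalence.to T-not ¬Gab ∘ proj₂ ∘ F⊆G a b ∘ (a<b ,_))

  compl-involutive : compl (compl F) ≐ₑ F
  compl-involutive {F} = (λ a b (a<b , t) → a<b , subst T (not-involutive (F a b)) t)
                       , (λ a b (a<b , t) → a<b , subst T (sym (not-involutive (F a b))) t)

  Adj-mono : S ⊆ₑ S′ → Adj S u v → Adj S′ u v
  Adj-mono S⊆S′ (inj₁ uv∈S) = inj₁ (S⊆S′ _ _ uv∈S)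
  Adj-mono S⊆S′ (inj₂ vu∈S) = inj₂ (S⊆S′ _ _ vu∈S)

  Adj-sym : Adj S u v → Adj S v u
  Adj-sym = [ inj₂ , inj₁ ]′

  Walk-mono : S ⊆ₑ S′ → Walk S u v → Walk S′ u v
  Walk-mono S⊆S′ here       = here
  Walk-mono S⊆S′ (step e p) = step (Adj-mono S⊆S′ e) (Walk-mono S⊆S′ p)

  _++ʷ_ : Walk S u v → Walk S v w → Walk S u w
  here     ++ʷ q = q
  step e p ++ʷ q = step e (p ++ʷ q)

  reverseʷ : Walk S u v → Walk S v u
  reverseʷ here       = here
  reverseʷ {S = S} (step e p) = reverseʷ p ++ʷ step (Adj-sym {S = S} e) here

  lengthʷ : Walk S u v → ℕ
  lengthʷ here       = 0
  lengthʷ (step _ p) = suc (lengthʷ p)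

  vertices : Walk S u v → List V
  vertices {u = u} here       = u ∷ []
  vertices {u = u} (step _ p) = u ∷ vertices p

  Acyclic-mono : S ⊆ₑ S′ → Acyclic S′ → Acyclic S
  Acyclic-mono S⊆S′ acyclic (n , v , v-inj , v-adj , closing) =
    acyclic (n , v , v-inj , Adj-mono S⊆S′ ∘ v-adj , Adj-mono S⊆S′ closing)

  IsPath : Walk S u v → Set
  IsPath p = Unique (vertices p)

  dropUntil : (p : Walk S u v) → IsPath p → x ∈ vertices p → Σ (Walk S x v) IsPath
  dropUntil here       p-path       (here refl) = here , p-path
  dropUntil (step e p) p-path       (here refl) = step e p , p-path
  dropUntil (step _ p) (_ ∷ p-path) (there x∈p) = dropUntil p p-path x∈p

  walk⇒path : Walk S u v → Σ (Walk S u v) IsPath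
  walk⇒path here = here , [] ∷ []
  walk⇒path {u = u} (step e p) with walk⇒path p
  ... | q , q-path with u ∈? vertices q
  ...   | yes u∈q = dropUntil q q-path u∈q
  ...   | no  u∉q = step e q , ¬Any⇒All¬ _ u∉q ∷ q-path

  vertexAt : (p : Walk S u v) → Fin (suc (lengthʷ p)) → V
  vertexAt {u = u} here       _       = u
  vertexAt {u = u} (step _ p) zero    = u
  vertexAt         (step _ p) (suc t) = vertexAt p t

  vertexAt-first : (p : Walk S u v) → vertexAt p zero ≡ u
  vertexAt-first here       = refl
  vertexAt-first (step _ _) = refl

  vertexAt-last : (p : Walk S u v) → vertexAt p (fromℕ (lengthʷ p)) ≡ v
  vertexAt-last here       = refl
  vertexAt-last (step _ p) = vertexAt-last p

  vertexAt-adjacent : (p : Walk S u v) (t : Fin (lengthʷ p)) → Adj S (vertexAt p (inject₁ t)) (vertexAt p (suc t))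
  vertexAt-adjacent {S = S} (step e p) zero = subst (Adj S _) (sym (vertexAt-first p)) e
  vertexAt-adjacent         (step _ p) (suc t) = vertexAt-adjacent p t

  vertexAt-∈ : (p : Walk S u v) (t : Fin (suc (lengthʷ p))) → vertexAt p t ∈ vertices p
  vertexAt-∈ here       _       = here refl
  vertexAt-∈ (step _ p) zero    = here refl
  vertexAt-∈ (step _ p) (suc t) = there (vertexAt-∈ p t)

  vertexAt-injective : (p : Walk S u v) → IsPath p → Injective _≡_ _≡_ (vertexAt p)
  vertexAt-injective here       _            {zero}  {zero}  _  = refl
  vertexAt-injective (step _ p) _            {zero}  {zero}  _  = refl
  vertexAt-injective (step _ p) (u∉p ∷ _)    {zero}  {suc t} eq = contradiction eq (All.lookup u∉p (vertexAt-∈ p t))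
  vertexAt-injective (step _ p) (u∉p ∷ _)    {suc s} {zero}  eq = contradiction (sym eq) (All.lookup u∉p (vertexAt-∈ p s))
  vertexAt-injective (step _ p) (_ ∷ p-path) {suc s} {suc t} eq = cong suc (vertexAt-injective p p-path eq)

  path⇒cycle : (p : Walk S u v) → IsPath p → 2 ≤ lengthʷ p → Adj S v u → HasCycle S
  path⇒cycle here                 _      ()                    _
  path⇒cycle (step _ here)        _      (s≤s ())              _
  path⇒cycle {S = S} {u} p@(step _ (step _ q)) p-path _ vu∈S =
    lengthʷ q , vertexAt p , vertexAt-injective p p-path , vertexAt-adjacent p ,
    subst (λ z → Adj S z u) (sym (vertexAt-last p)) vu∈S

  sequenceWalk : ∀ k (v : Fin (suc k) → V) → (∀ t → Adj S (v (inject₁ t)) (v (suc t))) →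
                 Walk S (v zero) (v (fromℕ k))
  sequenceWalk zero    v _     = here
  sequenceWalk (suc k) v v-adj = step (v-adj zero) (sequenceWalk k (v ∘ suc) (v-adj ∘ suc))

  -- Deleting an edge

  -- Opaque, so that a, b and S can be inferred from removeEdge a b S by unification.
  opaque
    removeEdge : V → V → EdgeSet i → EdgeSet i
    removeEdge a b S x y = S x y ∧ not (does (≡-dec _≟_ _≟_ (x , y) (a , b)))

    ∋-removeEdge : removeEdge a b S ∋ₑ x , y ⇔ (S ∋ₑ x , y × (x , y) ≢ (a , b))
    ∋-removeEdge {a} {b} {S} {x} {y} = mk⇔
      (λ (x<y , t) → let Sxy , xy≢ab = Equivalence.to T-∧ t in (x<y , Sxy) , Equivalence.to (T-not-does xy≟ab) xy≢ab)
      (λ ((x<y , Sxy) , xy≢ab) → x<y , Equivalence.from T-∧ (Sxy , Equivalence.from (T-not-does xy≟ab) xy≢ab))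
      where
      xy≟ab : Dec ((x , y) ≡ (a , b))
      xy≟ab = ≡-dec _≟_ _≟_ (x , y) (a , b)

  removeEdge-⊆ : removeEdge a b S ⊆ₑ S
  removeEdge-⊆ _ _ = proj₁ ∘ Equivalence.to ∋-removeEdge

  removeEdge-∌ : ¬ removeEdge a b S ∋ₑ a , b
  removeEdge-∌ ab∈S∖ab = proj₂ (Equivalence.to ∋-removeEdge ab∈S∖ab) refl

  ∋-removeEdge-or : S ∋ₑ x , y → (x , y) ≡ (a , b) ⊎ removeEdge a b S ∋ₑ x , y
  ∋-removeEdge-or {x = x} {y} {a} {b} xy∈S =
    Sum.map₂ (λ xy≢ab → Equivalence.from ∋-removeEdge (xy∈S , xy≢ab)) (toSum (≡-dec _≟_ _≟_ (x , y) (a , b)))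

  Adj-removeEdge : Adj S x y → (x , y) ≢ (a , b) → (x , y) ≢ (b , a) → Adj (removeEdge a b S) x y
  Adj-removeEdge (inj₁ xy∈S) xy≢ab _     = inj₁ (Equivalence.from ∋-removeEdge (xy∈S , xy≢ab))
  Adj-removeEdge (inj₂ yx∈S) _     xy≢ba = inj₂ (Equivalence.from ∋-removeEdge (yx∈S , λ { refl → xy≢ba refl }))

  vertices-Walk-mono : (S⊆S′ : S ⊆ₑ S′) (p : Walk S u v) → vertices (Walk-mono S⊆S′ p) ≡ vertices p
  vertices-Walk-mono _     here       = refl
  vertices-Walk-mono S⊆S′ (step _ p) = cong (_ ∷_) (vertices-Walk-mono S⊆S′ p)

  ¬Adj-removeEdge : a Fin.< b → ¬ Adj (removeEdge a b S) a b
  ¬Adj-removeEdge _   (inj₁ ab∈S∖ab) = removeEdge-∌ ab∈S∖ab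
  ¬Adj-removeEdge a<b (inj₂ (b<a , _)) = Fin.<-asym a<b b<a

  removeEdge-joined⇒cycle : S ∋ₑ a , b → Walk (removeEdge a b S) a b → HasCycle S
  removeEdge-joined⇒cycle (a<b , _) p with walk⇒path p
  removeEdge-joined⇒cycle (a<b , _) p | here , _ = contradiction a<b (Fin.<-irrefl refl)
  removeEdge-joined⇒cycle (a<b , _) p | step ab∈S∖ab here , _ = contradiction ab∈S∖ab (¬Adj-removeEdge a<b)
  removeEdge-joined⇒cycle ab∈S p | q@(step _ (step _ _)) , q-path =
    path⇒cycle (Walk-mono removeEdge-⊆ q) (subst Unique (sym (vertices-Walk-mono removeEdge-⊆ q)) q-path)
               (s≤s (s≤s z≤n)) (inj₂ ab∈S)

  cycle⇒removeEdge-joined : HasCycle S → ∃₂ λ a b → S ∋ₑ a , b × Walk (removeEdge a b S) a b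
  cycle⇒removeEdge-joined {S} (n , v , v-inj , v-adj , closing) =
    [ (λ e → _ , _ , e , reverseʷ (around ≢last-first ≢first-last))
    , (λ e → _ , _ , e , around ≢first-last ≢last-first) ]′ closing
    where
    last : Fin (suc (suc (suc n)))
    last = fromℕ (suc (suc n))

    ≢last-first : ∀ t → (v (inject₁ t) , v (suc t)) ≢ (v last , v zero)
    ≢last-first t eq with v-inj (cong proj₂ eq)
    ... | ()

    ≢first-last : ∀ t → (v (inject₁ t) , v (suc t)) ≢ (v zero , v last)
    ≢first-last zero    eq with v-inj (cong proj₂ eq)
    ... | ()
    ≢first-last (suc t) eq with v-inj (cong proj₁ eq)
    ... | ()

    around : (∀ t → (v (inject₁ t) , v (suc t)) ≢ (a , b)) → (∀ t → (v (inject₁ t) , v (suc t)) ≢ (b , a)) →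
             Walk (removeEdge a b S) (v zero) (v last)
    around ≢ab ≢ba = sequenceWalk _ v λ t → Adj-removeEdge (v-adj t) (≢ab t) (≢ba t)

  edge? : (S : EdgeSet i) → Decidable (λ (p : V × V) → S ∋ₑ proj₁ p , proj₂ p)
  edge? S p = (proj₁ p <? proj₂ p) ×-dec T? (S (proj₁ p) (proj₂ p))

  allPairs≡cartesianProduct : allPairs i ≡ cartesianProduct (allFin i) (allFin i)
  allPairs≡cartesianProduct = concatMap-pairs≡cartesianProduct (allFin i) (allFin i)

  allPairs-unique : Unique (allPairs i)
  allPairs-unique = subst Unique (sym allPairs≡cartesianProduct) (cartesianProduct⁺ (allFin⁺ i) (allFin⁺ i))

  ∈-allPairs : (x , y) ∈ allPairs i
  ∈-allPairs {x} {y} =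
    subst ((x , y) ∈_) (sym allPairs≡cartesianProduct) (∈-cartesianProduct⁺ (∈-allFin x) (∈-allFin y))

  card-removeEdge : S ∋ₑ a , b → card S ≡ suc (card (removeEdge a b S))
  card-removeEdge {S} {a} {b} =
    length-filter-without (edge? S) (edge? (removeEdge a b S)) ∋-removeEdge allPairs-unique ∈-allPairs

  card≡0⇒edgeless : card S ≡ 0 → ¬ S ∋ₑ a , b
  card≡0⇒edgeless |S|≡0 ab∈S = ℕ.0≢1+n (trans (sym |S|≡0) (card-removeEdge ab∈S))

  card≡suc⇒edge : ∀ {k} → card S ≡ suc k → ∃₂ λ a b → S ∋ₑ a , b
  card≡suc⇒edge {S} |S|≡1+k =
    let (a , b) , ab∈edges = length≡suc⇒∈ {xs = filter (edge? S) (allPairs i)} |S|≡1+k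
    in a , b , proj₂ (∈-filter⁻ (edge? S) {xs = allPairs i} ab∈edges)

  edgeless⇒card≡0 : (∀ {a b} → ¬ S ∋ₑ a , b) → card S ≡ 0
  edgeless⇒card≡0 {S} edgeless = cong length (List.filter-none (edge? S) (All.universal (λ _ → edgeless) (allPairs i)))

  removeEdge-induction : ∀ {p} (P : EdgeSet i → Set p) →
                         (∀ {S} → (∀ {a b} → ¬ S ∋ₑ a , b) → P S) →
                         (∀ {S a b} → S ∋ₑ a , b → P (removeEdge a b S) → P S) →
                         ∀ S → P S
  removeEdge-induction P edgeless removal S = byCard (card S) S refl
    where
    byCard : ∀ k S → card S ≡ k → P S
    byCard zero    S |S|≡0   = edgeless (card≡0⇒edgeless |S|≡0)
    byCard (suc k) S |S|≡1+k =
      let a , b , ab∈S = card≡suc⇒edge |S|≡1+k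
      in removal ab∈S (byCard k (removeEdge a b S) (ℕ.suc-injective (trans (sym (card-removeEdge ab∈S)) |S|≡1+k)))

  -- Connected components

  record Splitting (S : EdgeSet i) (j : ℕ) : Set where
    field
      label      : V → Fin j
      surjective : StrictlySurjective _≡_ label
      respects   : ∀ {a b} → S ∋ₑ a , b → label a ≡ label b

    respects-walk : ∀ {a b} → Walk S a b → label a ≡ label b
    respects-walk here                  = refl
    respects-walk (step (inj₁ ab∈S) p) = trans (respects ab∈S) (respects-walk p)
    respects-walk (step (inj₂ ba∈S) p) = trans (sym (respects ba∈S)) (respects-walk p)

  record Components (S : EdgeSet i) (m : ℕ) : Set where
    field
      splitting : Splitting S m
    open Splitting splitting public
    field
      connects : ∀ {a b} → label a ≡ label b → Walk S a b

  Splitting-mono : S′ ⊆ₑ S → ∀ {j} → Splitting S j → Splitting S′ j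
  Splitting-mono S′⊆S σ = record { Splitting σ ; respects = Splitting.respects σ ∘ S′⊆S _ _ }

  Splitting-map : ∀ {j k} (g : Fin j → Fin k) → StrictlySurjective _≡_ g → Splitting S j → Splitting S k
  Splitting-map g g-surjective σ = record
    { label      = g ∘ label
    ; surjective = λ k → let (l , gl≡k) = g-surjective k ; (x , x↦l) = surjective l
                         in x , trans (cong g x↦l) gl≡k
    ; respects   = cong g ∘ respects
    }
    where open Splitting σ

  Splitting-coarsen : ∀ {j k} → 1 ≤ k → k ≤′ j → Splitting S j → Splitting S k
  Splitting-coarsen _           ℕ.≤′-refl σ = σ
  Splitting-coarsen {j = suc (suc j)} 1≤k (ℕ.≤′-step k≤′j) σ =
    Splitting-coarsen 1≤k k≤′j (Splitting-map (identify 1≢0) (identify-surjective 1≢0) σ)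
    where
    1≢0 : suc zero ≢ zero
    1≢0 ()
  Splitting-coarsen {j = suc zero} (s≤s z≤n) (ℕ.≤′-step (ℕ.≤′-reflexive ()))

  Splitting-≤-Components : ∀ {j m} → Splitting S j → Components S m → j ≤ m
  Splitting-≤-Components {j = j} {m} σ C = Fin.injective⇒≤ {f = componentOf} componentOf-injective
    where
    open Components C
    representative : Fin j → V
    representative k = proj₁ (Splitting.surjective σ k)
    componentOf : Fin j → Fin m
    componentOf = label ∘ representative
    componentOf-injective : Injective _≡_ _≡_ componentOf
    componentOf-injective {k} {k′} eq =
      trans (sym (proj₂ (Splitting.surjective σ k)))
            (trans (Splitting.respects-walk σ (connects eq)) (proj₂ (Splitting.surjective σ k′)))

  Components-unique : ∀ {m m′} → Components S m → Components S m′ → m ≡ m′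
  Components-unique C C′ = ℕ.≤-antisym (Splitting-≤-Components (Components.splitting C) C′)
                                        (Splitting-≤-Components (Components.splitting C′) C)

  Components-edgeless : (∀ {a b} → ¬ S ∋ₑ a , b) → Components S i
  Components-edgeless edgeless = record
    { splitting = record { label = id ; surjective = λ k → k , refl ; respects = λ ab∈S → contradiction ab∈S edgeless }
    ; connects  = λ { refl → here }
    }

  module _ {m} (ab∈S : S ∋ₑ a , b) (C : Components (removeEdge a b S) m) where
    open Components C

    Components-addEdge-within : label a ≡ label b → Components S m
    Components-addEdge-within a~b = record
      { splitting = record { Splitting splitting ; respects = respects′ }
      ; connects  = Walk-mono removeEdge-⊆ ∘ connects
      }
      where
      respects′ : ∀ {x y} → S ∋ₑ x , y → label x ≡ label y
      respects′ xy∈S with ∋-removeEdge-or {a = a} {b = b} xy∈S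
      ... | inj₁ refl     = a~b
      ... | inj₂ xy∈S∖ab = respects xy∈S∖ab

    Components-addEdge-between : label a ≢ label b → Components S (pred m)
    Components-addEdge-between a≁b = merged (≡suc-pred (label a))
      where
      b≢a : label b ≢ label a
      b≢a = a≁b ∘ sym
      merged : ∀ {m′} → m ≡ suc m′ → Components S m′
      merged {m′} refl = record
        { splitting = record { Splitting (Splitting-map merge (identify-surjective b≢a) splitting) ; respects = respects′ }
        ; connects  = connects′ ∘ identify-injective b≢a
        }
        where
        merge : Fin m → Fin m′
        merge = identify b≢a

        respects′ : ∀ {x y} → S ∋ₑ x , y → merge (label x) ≡ merge (label y)
        respects′ xy∈S with ∋-removeEdge-or {a = a} {b = b} xy∈S
        ... | inj₁ refl     = sym (identify-merges b≢a)
        ... | inj₂ xy∈S∖ab = cong merge (respects xy∈S∖ab)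

        lift : ∀ {x y} → Walk (removeEdge a b S) x y → Walk S x y
        lift = Walk-mono removeEdge-⊆

        connects′ : ∀ {x y} → label x ≡ label y
                              ⊎ (label x ≡ label b × label y ≡ label a)
                              ⊎ (label x ≡ label a × label y ≡ label b) → Walk S x y
        connects′ (inj₁ x~y)                = lift (connects x~y)
        connects′ (inj₂ (inj₁ (x~b , y~a))) = lift (connects x~b) ++ʷ step (inj₂ ab∈S) (lift (connects (sym y~a)))
        connects′ (inj₂ (inj₂ (x~a , y~b))) = lift (connects x~a) ++ʷ step (inj₁ ab∈S) (lift (connects (sym y~b)))

  Components-addEdge : S ∋ₑ a , b → ∃ (Components (removeEdge a b S)) → ∃ (Components S)
  Components-addEdge {a = a} {b} ab∈S (m , C) with Components.label C a ≟ Components.label C b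
  ... | yes a~b = m , Components-addEdge-within ab∈S C a~b
  ... | no  a≁b = pred m , Components-addEdge-between ab∈S C a≁b

  components : (S : EdgeSet i) → ∃ (Components S)
  components = removeEdge-induction (∃ ∘ Components) (λ edgeless → i , Components-edgeless edgeless) Components-addEdge

  componentCount : EdgeSet i → ℕ
  componentCount = proj₁ ∘ components

  componentCount-components : Components S (componentCount S)
  componentCount-components = proj₂ (components _)

  Components⇒componentCount : ∀ {m} → Components S m → componentCount S ≡ m
  Components⇒componentCount = Components-unique componentCount-components

  Splitting⇒≤componentCount : ∀ {j} → Splitting S j → j ≤ componentCount S
  Splitting⇒≤componentCount σ = Splitting-≤-Components σ componentCount-components

  ≤componentCount⇒Splitting : ∀ {j} → 1 ≤ j → j ≤ componentCount S → Splitting S j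
  ≤componentCount⇒Splitting 1≤j j≤κ =
    Splitting-coarsen 1≤j (ℕ.≤⇒≤′ j≤κ) (Components.splitting componentCount-components)

  componentCount-antitone : S′ ⊆ₑ S → componentCount S ≤ componentCount S′
  componentCount-antitone S′⊆S =
    Splitting⇒≤componentCount (Splitting-mono S′⊆S (Components.splitting componentCount-components))

  componentCount-cong : S ≐ₑ S′ → componentCount S ≡ componentCount S′
  componentCount-cong (S⊆S′ , S′⊆S) = ℕ.≤-antisym (componentCount-antitone S′⊆S) (componentCount-antitone S⊆S′)

  componentCount-edgeless : (∀ {a b} → ¬ S ∋ₑ a , b) → componentCount S ≡ i
  componentCount-edgeless = Components⇒componentCount ∘ Components-edgeless

  componentCount-removeEdge-joined : S ∋ₑ a , b → Walk (removeEdge a b S) a b →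
                                     componentCount (removeEdge a b S) ≡ componentCount S
  componentCount-removeEdge-joined ab∈S p = sym (Components⇒componentCount
    (Components-addEdge-within ab∈S componentCount-components (Components.respects-walk componentCount-components p)))

  componentCount-removeBridge : Acyclic S → S ∋ₑ a , b → componentCount (removeEdge a b S) ≡ suc (componentCount S)
  componentCount-removeBridge {S} {a} {b} acyclic ab∈S = begin
    componentCount (removeEdge a b S)              ≡⟨ ≡suc-pred (label a) ⟩
    suc (pred (componentCount (removeEdge a b S))) ≡⟨ cong suc (sym (Components⇒componentCount merged)) ⟩
    suc (componentCount S)                         ∎
    where
    open ≡-Reasoning
    C : Components (removeEdge a b S) (componentCount (removeEdge a b S))
    C = componentCount-components
    open Components C
    a≁b : label a ≢ label b
    a≁b = acyclic ∘ removeEdge-joined⇒cycle ab∈S ∘ connects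
    merged : Components S (pred (componentCount (removeEdge a b S)))
    merged = Components-addEdge-between ab∈S C a≁b

  forest-componentCount : Acyclic S → componentCount S + card S ≡ i
  forest-componentCount = removeEdge-induction ForestFormula edgeless removal _
    where
    open ≡-Reasoning
    ForestFormula : EdgeSet i → Set
    ForestFormula S = Acyclic S → componentCount S + card S ≡ i

    edgeless : (∀ {a b} → ¬ S ∋ₑ a , b) → ForestFormula S
    edgeless {S} S-edgeless _ = begin
      componentCount S + card S ≡⟨ cong (componentCount S +_) (edgeless⇒card≡0 S-edgeless) ⟩
      componentCount S + 0      ≡⟨ ℕ.+-identityʳ _ ⟩
      componentCount S          ≡⟨ componentCount-edgeless S-edgeless ⟩
      i                         ∎

    removal : S ∋ₑ a , b → ForestFormula (removeEdge a b S) → ForestFormula S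
    removal {S} {a} {b} ab∈S formula acyclic = begin
      componentCount S + card S          ≡⟨ cong (componentCount S +_) (card-removeEdge ab∈S) ⟩
      componentCount S + suc (card S∖ab) ≡⟨ ℕ.+-suc _ _ ⟩
      suc (componentCount S) + card S∖ab ≡⟨ cong (_+ card S∖ab) (sym (componentCount-removeBridge acyclic ab∈S)) ⟩
      componentCount S∖ab + card S∖ab    ≡⟨ formula (Acyclic-mono removeEdge-⊆ acyclic) ⟩
      i                                  ∎
      where
      S∖ab : EdgeSet i
      S∖ab = removeEdge a b S

  edge-or-edgeless : (∃₂ λ a b → S ∋ₑ a , b) ⊎ (∀ {a b} → ¬ S ∋ₑ a , b)
  edge-or-edgeless {S} with card S in |S|
  ... | zero  = inj₂ (card≡0⇒edgeless |S|)
  ... | suc _ = inj₁ (card≡suc⇒edge |S|)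

  -- Faces and facets

  cutEdgesIn⇔respects : ∀ {j} (C : Partition i j) →
                        cutEdgesIn C F ⇔ (∀ {a b} → compl F ∋ₑ a , b → block C a ≡ block C b)
  cutEdgesIn⇔respects {F} C = mk⇔ to from
    where
    to : cutEdgesIn C F → ∀ {a b} → compl F ∋ₑ a , b → block C a ≡ block C b
    to cut {a} {b} (a<b , ¬Fab) with block C a ≟ block C b
    ... | yes a~b = a~b
    ... | no  a≁b = contradiction (proj₂ (cut a b a<b a≁b)) (Equivalence.to T-not ¬Fab)
    from : (∀ {a b} → compl F ∋ₑ a , b → block C a ≡ block C b) → cutEdgesIn C F
    from respects a b a<b a≁b with T? (F a b)
    ... | yes Fab = a<b , Fab
    ... | no ¬Fab = contradiction (respects (a<b , Equivalence.from T-not ¬Fab)) a≁b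

  partitionOf : ∀ {j} → Splitting S j → Partition i j
  partitionOf σ = record { block = label ; surj = strictlySurjective⇒surjective surjective }
    where open Splitting σ

  Face⇔¬Splitting : ∀ {j} → Face i j F ⇔ (¬ Splitting (compl F) j)
  Face⇔¬Splitting = mk⇔
    (λ face σ → face (partitionOf σ , Equivalence.from (cutEdgesIn⇔respects (partitionOf σ)) (Splitting.respects σ)))
    (λ ¬σ (C , cut) → ¬σ (record
      { label      = block C
      ; surjective = λ k → proj₁ (surj C k) , proj₂ (surj C k) refl
      ; respects   = Equivalence.to (cutEdgesIn⇔respects C) cut
      }))

  Face⇔componentCount< : ∀ {j} → 1 ≤ j → Face i j F ⇔ componentCount (compl F) < j
  Face⇔componentCount< 1≤j = mk⇔
    (λ face → ℕ.≰⇒> (Equivalence.to Face⇔¬Splitting face ∘ ≤componentCount⇒Splitting 1≤j))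
    (λ κ<j → Equivalence.from Face⇔¬Splitting (ℕ.<⇒≱ κ<j ∘ Splitting⇒≤componentCount))

  Facet⇔forest : ∀ {j} → 1 ≤ j → j ≤ i →
                 Facet i j F ⇔ (Acyclic (compl F) × suc (componentCount (compl F)) ≡ j)
  Facet⇔forest {F} {j} 1≤j j≤i = mk⇔ to from
    where
    Fᶜ : EdgeSet i
    Fᶜ = compl F

    face⇔ : ∀ {G} → Face i j G ⇔ componentCount (compl G) < j
    face⇔ = Face⇔componentCount< 1≤j

    to : Facet i j F → Acyclic Fᶜ × suc (componentCount Fᶜ) ≡ j
    to (face , maximal) = acyclic , ℕ.≤-antisym κ<j j≤1+κ
      where
      κ<j : componentCount Fᶜ < j
      κ<j = Equivalence.to face⇔ face

      removal-splits : Fᶜ ∋ₑ a , b → j ≤ componentCount (removeEdge a b Fᶜ)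
      removal-splits {a} {b} (a<b , ¬Fab) = ℕ.≮⇒≥ λ κ′<j →
        Equivalence.to T-not ¬Fab (proj₂ (maximal F∪ab (F∪ab-face κ′<j) F⊆F∪ab a b (a<b , F∪ab∋ab)))
        where
        F∪ab : EdgeSet i
        F∪ab = compl (removeEdge a b Fᶜ)
        F∪ab-face : componentCount (removeEdge a b Fᶜ) < j → Face i j F∪ab
        F∪ab-face = Equivalence.from face⇔ ∘ subst (_< j) (sym (componentCount-cong compl-involutive))
        F⊆F∪ab : F ⊆ₑ F∪ab
        F⊆F∪ab = ⊆ₑ-trans (proj₂ compl-involutive) (compl-antitone removeEdge-⊆)
        F∪ab∋ab : T (F∪ab a b)
        F∪ab∋ab = Equivalence.from T-not (removeEdge-∌ ∘ (a<b ,_))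

      acyclic : Acyclic Fᶜ
      acyclic cycle =
        let a , b , ab∈Fᶜ , p = cycle⇒removeEdge-joined cycle
        in ℕ.<⇒≱ κ<j (subst (j ≤_) (componentCount-removeEdge-joined ab∈Fᶜ p) (removal-splits ab∈Fᶜ))

      j≤1+κ : j ≤ suc (componentCount Fᶜ)
      j≤1+κ with edge-or-edgeless {Fᶜ}
      ... | inj₁ (a , b , ab∈Fᶜ) = subst (j ≤_) (componentCount-removeBridge acyclic ab∈Fᶜ) (removal-splits ab∈Fᶜ)
      ... | inj₂ Fᶜ-edgeless = contradiction (subst (_< j) (componentCount-edgeless Fᶜ-edgeless) κ<j) (ℕ.≤⇒≯ j≤i)

    from : Acyclic Fᶜ × suc (componentCount Fᶜ) ≡ j → Facet i j F
    from (acyclic , 1+κ≡j) = Equivalence.from face⇔ (ℕ.≤-reflexive 1+κ≡j) , maximal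
      where
      maximal : ∀ G → Face i j G → F ⊆ₑ G → G ⊆ₑ F
      maximal G G-face F⊆G a b (a<b , Gab) with T? (F a b)
      ... | yes Fab = a<b , Fab
      ... | no ¬Fab = contradiction (begin
        j                                  ≡⟨ sym 1+κ≡j ⟩
        suc (componentCount Fᶜ)            ≡⟨ sym (componentCount-removeBridge acyclic ab∈Fᶜ) ⟩
        componentCount (removeEdge a b Fᶜ) ≤⟨ componentCount-antitone Gᶜ⊆Fᶜ∖ab ⟩
        componentCount (compl G)           ∎) (ℕ.<⇒≱ (Equivalence.to face⇔ G-face))
        where
        open ℕ.≤-Reasoning
        ab∈Fᶜ : Fᶜ ∋ₑ a , b
        ab∈Fᶜ = a<b , Equivalence.from T-not ¬Fab
        Gᶜ⊆Fᶜ∖ab : compl G ⊆ₑ removeEdge a b Fᶜ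
        Gᶜ⊆Fᶜ∖ab x y xy∈Gᶜ = Equivalence.from ∋-removeEdge
          (compl-antitone F⊆G x y xy∈Gᶜ , λ { refl → Equivalence.to T-not (proj₂ xy∈Gᶜ) Gab })

  forest-card : ∀ {j} → Acyclic S → j ≤ i → suc (componentCount S) ≡ j ⇔ card S ≡ i ∸ j + 1
  forest-card acyclic = suc≡⇔≡∸+1 (forest-componentCount acyclic)

  Connected⇔componentCount≡1 : 1 ≤ i → Connected S ⇔ componentCount S ≡ 1
  Connected⇔componentCount≡1 {S} 1≤i = mk⇔
    (λ connected → ℕ.≤-antisym (Fin.injective⇒≤ {f = λ _ → zero {0}} (λ _ → all-connected connected _ _))
                               nonempty)
    (λ κ≡1 u v → connects (Fin1-unique κ≡1 (label u) (label v)))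
    where
    open Components (componentCount-components {S})
    nonempty : 1 ≤ componentCount S
    nonempty = ℕ.≤-trans (s≤s z≤n) (Fin.toℕ<n (label (Fin.fromℕ< 1≤i)))
    all-connected : Connected S → (k k′ : Fin (componentCount S)) → k ≡ k′
    all-connected connected k k′ =
      let (u , u↦k) = surjective k ; (v , v↦k′) = surjective k′
      in trans (sym u↦k) (trans (respects-walk (connected u v)) v↦k′)

  ≐ₑ-compl⇒compl-≐ₑ : F ≐ₑ compl S → compl F ≐ₑ S
  ≐ₑ-compl⇒compl-≐ₑ (F⊆Sᶜ , Sᶜ⊆F) = ⊆ₑ-trans (compl-antitone Sᶜ⊆F) (proj₁ compl-involutive)
                                    , ⊆ₑ-trans (proj₂ compl-involutive) (compl-antitone F⊆Sᶜ)

  Facet⇔complement-of-forest : ∀ {j} → 1 ≤ j → j ≤ i →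
    Facet i j F ⇔ Σ (EdgeSet i) (λ S → (card S ≡ i ∸ j + 1) × Acyclic S × (F ≐ₑ compl S))
  Facet⇔complement-of-forest {F} 1≤j j≤i = mk⇔
    (λ facet → let acyclic , 1+κ≡j = Equivalence.to (Facet⇔forest 1≤j j≤i) facet
               in compl F , Equivalence.to (forest-card acyclic j≤i) 1+κ≡j , acyclic , swap compl-involutive)
    (λ (S , |S| , acyclic , F≐Sᶜ) → let Fᶜ≐S = ≐ₑ-compl⇒compl-≐ₑ F≐Sᶜ in
      Equivalence.from (Facet⇔forest 1≤j j≤i)
        ( Acyclic-mono (proj₁ Fᶜ≐S) acyclic
        , trans (cong suc (componentCount-cong Fᶜ≐S)) (Equivalence.from (forest-card acyclic j≤i) |S|)))

  Facet₂⇔complement-of-spanningTree : 2 ≤ i →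
    Facet i 2 F ⇔ Σ (EdgeSet i) (λ T → SpanningTree T × (F ≐ₑ compl T))
  Facet₂⇔complement-of-spanningTree 2≤i = mk⇔
    (λ facet → let S , |S| , acyclic , F≐Sᶜ = Equivalence.to (Facet⇔complement-of-forest (s≤s z≤n) 2≤i) facet
               in S , (acyclic , Equivalence.from (Connected⇔card acyclic) |S|) , F≐Sᶜ)
    (λ (T , (acyclic , connected) , F≐Tᶜ) →
      Equivalence.from (Facet⇔complement-of-forest (s≤s z≤n) 2≤i)
        (T , Equivalence.to (Connected⇔card acyclic) connected , acyclic , F≐Tᶜ))
    where
    Connected⇔card : Acyclic S → Connected S ⇔ (card S ≡ i ∸ 2 + 1)
    Connected⇔card acyclic =
      ⇔-trans (Connected⇔componentCount≡1 (ℕ.≤-trans (s≤s z≤n) 2≤i))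
              (⇔-trans (mk⇔ (cong suc) ℕ.suc-injective) (forest-card acyclic 2≤i))

mainTheorem2 :
    (∀ (i j : ℕ) → 2 ≤ i → 1 ≤ j → j ≤ i → (F : EdgeSet i) →
      Facet i j F ⇔ Σ (EdgeSet i) (λ S → (card S ≡ i ∸ j + 1) × Acyclic S × (F ≐ₑ compl S)))
    × (∀ (i : ℕ) → 2 ≤ i → (F : EdgeSet i) →
      Facet i 2 F ⇔ Σ (EdgeSet i) (λ T → SpanningTree T × (F ≐ₑ compl T)))
mainTheorem2 = (λ _ _ _ 1≤j j≤i _ → Facet⇔complement-of-forest 1≤j j≤i)
             , (λ _ 2≤i _ → Facet₂⇔complement-of-spanningTree 2≤i)
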